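{- For every integer $n\ge 0$, \[ \binom{2n}{n}^2\sum_{k}\binom{n}{k}^2\binom{3n}{n+k}=\frac{(3n)!}{n!^3}\sum_{k}\binom{n}{k}\binom{2n}{k}\binom{2k}{n}=\frac{(3n)!}{n!^3}\sum_{k}\binom{n}{k}\binom{2n}{k}\binom{2n}{n-k}, \] where all sums run over $k=0,\dots,n$.
   Context: $\binom{m}{j}$ is the usual binomial coefficient for integers $m\ge0$, with $\binom{m}{j}=0$ if $j<0$ or $j>m$. -}

module Defs where

open import Data.Nat using (ℕ; zero; suc; _+_)

sumTo : ℕ → (ℕ → ℕ) → ℕ
sumTo zero    f = f zero
sumTo (suc n) f = sumTo n f + f (suc n)

-- The first identity holds termwise: multiplied by k! (n−k)! (n+k)! (2n−k)!, both summands
-- become (2n)!² (3n)! C(n,k).  For the second, expand C(2k,n) = Σⱼ C(k,j) C(k,n−j) by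
-- Vandermonde and exchange the sums.  For fixed j only k = (n−j) + i with i ≤ j contributes,
-- and three applications of C(m,p) C(p,q) = C(m,q) C(m−q,p−q) turn the summand into
-- C(n,n−j) C(2n,n−j) C(n+j,i) C(n−j,j−i); a second Vandermonde convolution sums this over i
-- to C(n,j) C(2n,n−j) C(2n,j).

module Submission where

open import Defs
open import Data.Nat using (ℕ; _+_; _*_; _∸_; _^_)
open import Data.Nat.Combinatorics using (_C_)
open import Data.Nat.Base using (_!)
open import Data.Product using (_×_)
open import Relation.Binary.PropositionalEquality using (_≡_)

open import Data.Nat.Base using (zero; suc; _≤_; _<_; z≤n; s≤s; NonZero)
open import Data.Nat.Combinatorics
  using (nCk≡n!/k![n-k]!; k![n∸k]!∣n!; k>n⇒nCk≡0; nCk≡nC[n∸k]; nCk+nC[k+1]≡[n+1]C[k+1])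
open import Data.Nat.DivMod using (m/n*n≡m)
open import Data.Nat.Properties
open import Algebra.Properties.CommutativeSemigroup +-commutativeSemigroup
  using (interchange; x∙yz≈y∙xz)
open import Data.Nat.Tactic.RingSolver using (solve-∀)
open import Data.Product using (_,_)
open import Function using (_∘_)
open import Relation.Binary.PropositionalEquality
  using (refl; sym; trans; cong; cong₂; subst; module ≡-Reasoning)
open import Relation.Nullary using (yes; no)

open ≡-Reasoning

sumTo-cong : ∀ n {f g : ℕ → ℕ} → (∀ i → i ≤ n → f i ≡ g i) → sumTo n f ≡ sumTo n g
sumTo-cong zero    f≡g = f≡g 0 z≤n
sumTo-cong (suc n) f≡g =
  cong₂ _+_ (sumTo-cong n (λ i i≤n → f≡g i (m≤n⇒m≤1+n i≤n))) (f≡g (suc n) ≤-refl)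

sumTo-zero : ∀ n {f : ℕ → ℕ} → (∀ i → i ≤ n → f i ≡ 0) → sumTo n f ≡ 0
sumTo-zero zero    f≡0 = f≡0 0 z≤n
sumTo-zero (suc n) f≡0 =
  cong₂ _+_ (sumTo-zero n (λ i i≤n → f≡0 i (m≤n⇒m≤1+n i≤n))) (f≡0 (suc n) ≤-refl)

sumTo-distrib-+ : ∀ n (f g : ℕ → ℕ) → sumTo n (λ i → f i + g i) ≡ sumTo n f + sumTo n g
sumTo-distrib-+ zero    f g = refl
sumTo-distrib-+ (suc n) f g = trans (cong (_+ (f (suc n) + g (suc n))) (sumTo-distrib-+ n f g))
                                    (interchange (sumTo n f) (sumTo n g) (f (suc n)) (g (suc n)))

*-distribˡ-sumTo : ∀ c n (f : ℕ → ℕ) → c * sumTo n f ≡ sumTo n (λ i → c * f i)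
*-distribˡ-sumTo c zero    f = refl
*-distribˡ-sumTo c (suc n) f =
  trans (*-distribˡ-+ c (sumTo n f) (f (suc n))) (cong (_+ c * f (suc n)) (*-distribˡ-sumTo c n f))

sumTo-comm : ∀ m n (f : ℕ → ℕ → ℕ) →
  sumTo m (λ k → sumTo n (f k)) ≡ sumTo n (λ j → sumTo m (λ k → f k j))
sumTo-comm zero    n f = refl
sumTo-comm (suc m) n f = trans (cong (_+ sumTo n (f (suc m))) (sumTo-comm m n f))
                               (sym (sumTo-distrib-+ n (λ j → sumTo m (λ k → f k j)) (f (suc m))))

sumTo-suc : ∀ n (f : ℕ → ℕ) → sumTo (suc n) f ≡ f 0 + sumTo n (f ∘ suc)
sumTo-suc zero    f = refl
sumTo-suc (suc n) f = trans (cong (_+ f (suc (suc n))) (sumTo-suc n f)) (+-assoc (f 0) _ _)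

sumTo-shift : ∀ a n {f : ℕ → ℕ} → (∀ k → k < a → f k ≡ 0) →
  sumTo (a + n) f ≡ sumTo n (λ i → f (a + i))
sumTo-shift zero    n f<a≡0 = refl
sumTo-shift (suc a) n {f} f<a≡0 = begin
  sumTo (suc (a + n)) f          ≡⟨ sumTo-suc (a + n) f ⟩
  f 0 + sumTo (a + n) (f ∘ suc)  ≡⟨ cong₂ _+_ (f<a≡0 0 (s≤s z≤n))
                                              (sumTo-shift a n (λ k k<a → f<a≡0 (suc k) (s≤s k<a))) ⟩
  sumTo n (λ i → f (suc (a + i))) ∎

vandermonde : ∀ x y n → sumTo n (λ i → (x C i) * (y C (n ∸ i))) ≡ (x + y) C n
vandermonde zero    y zero    = +-identityʳ (y C 0)
vandermonde zero    y (suc n) = begin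
  sumTo (suc n) (λ i → (0 C i) * (y C (suc n ∸ i)))  ≡⟨ sumTo-suc n _ ⟩
  1 * (y C suc n) + sumTo n (λ _ → 0)                 ≡⟨ cong₂ _+_ (*-identityˡ _)
                                                                   (sumTo-zero n (λ _ _ → refl)) ⟩
  y C suc n + 0                                       ≡⟨ +-identityʳ _ ⟩
  y C suc n                                           ∎
vandermonde (suc x) y zero    = refl
vandermonde (suc x) y (suc n) = begin
  sumTo (suc n) (λ i → (suc x C i) * (y C (suc n ∸ i)))
    ≡⟨ sumTo-suc n _ ⟩
  1 * (y C suc n) + sumTo n (λ i → (suc x C suc i) * (y C (n ∸ i)))
    ≡⟨ cong₂ _+_ (*-identityˡ _)
                 (trans (sumTo-cong n (λ i _ → pascal i)) (sumTo-distrib-+ n _ _)) ⟩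
  y C suc n + (sumTo n (λ i → (x C i) * (y C (n ∸ i))) + tail)
    ≡⟨ x∙yz≈y∙xz (y C suc n) _ tail ⟩
  sumTo n (λ i → (x C i) * (y C (n ∸ i))) + (y C suc n + tail)
    ≡⟨ cong₂ _+_ (vandermonde x y n)
                 (trans (cong (_+ tail) (sym (*-identityˡ _))) (sym (sumTo-suc n _))) ⟩
  (x + y) C n + sumTo (suc n) (λ i → (x C i) * (y C (suc n ∸ i)))
    ≡⟨ cong ((x + y) C n +_) (vandermonde x y (suc n)) ⟩
  (x + y) C n + (x + y) C suc n
    ≡⟨ nCk+nC[k+1]≡[n+1]C[k+1] (x + y) n ⟩
  suc (x + y) C suc n ∎
  where
  tail : ℕ
  tail = sumTo n (λ i → (x C suc i) * (y C (n ∸ i)))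
  pascal : ∀ i →
    (suc x C suc i) * (y C (n ∸ i)) ≡ (x C i) * (y C (n ∸ i)) + (x C suc i) * (y C (n ∸ i))
  pascal i = trans (cong (_* (y C (n ∸ i))) (sym (nCk+nC[k+1]≡[n+1]C[k+1] x i)))
                   (*-distribʳ-+ (y C (n ∸ i)) (x C i) (x C suc i))

nCk*[k!*r!]≡n! : ∀ {n} k r → k + r ≡ n → (n C k) * (k ! * r !) ≡ n !
nCk*[k!*r!]≡n! k r refl = subst (λ s → ((k + r) C k) * (k ! * s !) ≡ (k + r) !)
                                (m+n∸m≡n k r) (nCk*[k!*[n∸k]!]≡n! (m≤m+n k r))
  where
  nCk*[k!*[n∸k]!]≡n! : ∀ {n k} → k ≤ n → (n C k) * (k ! * (n ∸ k) !) ≡ n !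
  nCk*[k!*[n∸k]!]≡n! {n} {k} k≤n = trans (cong (_* (k ! * (n ∸ k) !)) (nCk≡n!/k![n-k]! k≤n))
                                        (m/n*n≡m {{k !* (n ∸ k) !≢0}} (k![n∸k]!∣n! k≤n))

nCk*kCj≡nCj*[n∸j]C[k∸j] : ∀ {n k j} → j ≤ k →
  (n C k) * (k C j) ≡ (n C j) * ((n ∸ j) C (k ∸ j))
nCk*kCj≡nCj*[n∸j]C[k∸j] {n} {k} {j} j≤k with k ≤? n
... | yes k≤n = *-cancelʳ-≡ _ _ D {{D≢0}} (trans lhs (sym rhs))
  where
  D : ℕ
  D = j ! * ((k ∸ j) ! * (n ∸ k) !)
  D≢0 : NonZero D
  D≢0 = m*n≢0 _ _ {{j !≢0}} {{(k ∸ j) !* (n ∸ k) !≢0}}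
  [k∸j]+[n∸k]≡n∸j : (k ∸ j) + (n ∸ k) ≡ n ∸ j
  [k∸j]+[n∸k]≡n∸j = trans (+-comm (k ∸ j) (n ∸ k))
                          (trans (sym (+-∸-assoc (n ∸ k) j≤k)) (cong (_∸ j) (m∸n+n≡m k≤n)))
  ab[cd]e≡a[b[cd]e] : ∀ a b c d e → a * b * (c * (d * e)) ≡ a * (b * (c * d) * e)
  ab[cd]e≡a[b[cd]e] = solve-∀
  ab[cde]≡a[c[bde]] : ∀ a b c d e → a * b * (c * (d * e)) ≡ a * (c * (b * (d * e)))
  ab[cde]≡a[c[bde]] = solve-∀
  lhs : (n C k) * (k C j) * D ≡ n !
  lhs = begin
    (n C k) * (k C j) * D
      ≡⟨ ab[cd]e≡a[b[cd]e] (n C k) (k C j) (j !) ((k ∸ j) !) ((n ∸ k) !) ⟩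
    (n C k) * ((k C j) * (j ! * (k ∸ j) !) * (n ∸ k) !)
      ≡⟨ cong (λ s → (n C k) * (s * (n ∸ k) !)) (nCk*[k!*r!]≡n! j (k ∸ j) (m+[n∸m]≡n j≤k)) ⟩
    (n C k) * (k ! * (n ∸ k) !)
      ≡⟨ nCk*[k!*r!]≡n! k (n ∸ k) (m+[n∸m]≡n k≤n) ⟩
    n ! ∎
  rhs : (n C j) * ((n ∸ j) C (k ∸ j)) * D ≡ n !
  rhs = begin
    (n C j) * ((n ∸ j) C (k ∸ j)) * D
      ≡⟨ ab[cde]≡a[c[bde]] (n C j) ((n ∸ j) C (k ∸ j)) (j !) ((k ∸ j) !) ((n ∸ k) !) ⟩
    (n C j) * (j ! * (((n ∸ j) C (k ∸ j)) * ((k ∸ j) ! * (n ∸ k) !)))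
      ≡⟨ cong (λ s → (n C j) * (j ! * s)) (nCk*[k!*r!]≡n! (k ∸ j) (n ∸ k) [k∸j]+[n∸k]≡n∸j) ⟩
    (n C j) * (j ! * (n ∸ j) !)
      ≡⟨ nCk*[k!*r!]≡n! j (n ∸ j) (m+[n∸m]≡n (≤-trans j≤k k≤n)) ⟩
    n ! ∎
... | no k≰n = trans (cong (_* (k C j)) (k>n⇒nCk≡0 n<k)) (sym rhs≡0)
  where
  n<k = ≰⇒> k≰n
  rhs≡0 : (n C j) * ((n ∸ j) C (k ∸ j)) ≡ 0
  rhs≡0 with j ≤? n
  ... | yes j≤n = trans (cong ((n C j) *_) (k>n⇒nCk≡0 (∸-monoˡ-< n<k j≤n))) (*-zeroʳ (n C j))
  ... | no j≰n  = cong (_* ((n ∸ j) C (k ∸ j))) (k>n⇒nCk≡0 (≰⇒> j≰n))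

[a+i]Cj*jCi≡[a+i]Ca*aC[j∸i] : ∀ a {i j} → i ≤ j →
  ((a + i) C j) * (j C i) ≡ ((a + i) C a) * (a C (j ∸ i))
[a+i]Cj*jCi≡[a+i]Ca*aC[j∸i] a {i} {j} i≤j = begin
  ((a + i) C j) * (j C i)
    ≡⟨ nCk*kCj≡nCj*[n∸j]C[k∸j] i≤j ⟩
  ((a + i) C i) * ((a + i ∸ i) C (j ∸ i))
    ≡⟨ cong (_* ((a + i ∸ i) C (j ∸ i))) (nCk≡nC[n∸k] (m≤n+m i a)) ⟩
  ((a + i) C (a + i ∸ i)) * ((a + i ∸ i) C (j ∸ i))
    ≡⟨ cong (λ s → ((a + i) C s) * (s C (j ∸ i))) (m+n∸n≡m a i) ⟩
  ((a + i) C a) * (a C (j ∸ i)) ∎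

-- The factor (a+i) C a is consumed by the first revision and regenerated by the second.
shifted-term : ∀ m j a {i} → i ≤ j →
  ((j + a) C (a + i)) * (m C (a + i)) * (((a + i) C j) * ((a + i) C a))
    ≡ ((j + a) C a) * (m C a) * (((m ∸ a) C i) * (a C (j ∸ i)))
shifted-term m j a {i} i≤j = begin
  X₁ * X₂ * (X₃ * X₄)                        ≡⟨ ab[cd]≡bc[ad] X₁ X₂ X₃ X₄ ⟩
  X₂ * X₃ * (X₁ * X₄)                        ≡⟨ cong (X₂ * X₃ *_) X₁*X₄≡[j+a]Ca*jCi ⟩
  X₂ * X₃ * (N * (j C i))                    ≡⟨ ab[cd]≡ca[bd] X₂ X₃ N (j C i) ⟩
  N * X₂ * (X₃ * (j C i))                    ≡⟨ cong (N * X₂ *_) ([a+i]Cj*jCi≡[a+i]Ca*aC[j∸i] a i≤j) ⟩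
  N * X₂ * (X₄ * (a C (j ∸ i)))              ≡⟨ ab[cd]≡a[bc]d N X₂ X₄ (a C (j ∸ i)) ⟩
  N * (X₂ * X₄) * (a C (j ∸ i))              ≡⟨ cong (λ s → N * s * (a C (j ∸ i))) X₂*X₄≡mCa*[m∸a]Ci ⟩
  N * ((m C a) * ((m ∸ a) C i)) * (a C (j ∸ i))
                                             ≡⟨ ab[cd]≡a[bc]d N (m C a) ((m ∸ a) C i) (a C (j ∸ i)) ⟨
  N * (m C a) * (((m ∸ a) C i) * (a C (j ∸ i))) ∎
  where
  N X₁ X₂ X₃ X₄ : ℕ
  N  = (j + a) C a
  X₁ = (j + a) C (a + i)
  X₂ = m C (a + i)
  X₃ = (a + i) C j
  X₄ = (a + i) C a
  X₁*X₄≡[j+a]Ca*jCi : X₁ * X₄ ≡ N * (j C i)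
  X₁*X₄≡[j+a]Ca*jCi = trans (nCk*kCj≡nCj*[n∸j]C[k∸j] (m≤m+n a i))
                            (cong₂ (λ s t → N * (s C t)) (m+n∸n≡m j a) (m+n∸m≡n a i))
  X₂*X₄≡mCa*[m∸a]Ci : X₂ * X₄ ≡ (m C a) * ((m ∸ a) C i)
  X₂*X₄≡mCa*[m∸a]Ci = trans (nCk*kCj≡nCj*[n∸j]C[k∸j] (m≤m+n a i))
                            (cong (λ t → (m C a) * ((m ∸ a) C t)) (m+n∸m≡n a i))
  ab[cd]≡bc[ad] : ∀ a b c d → a * b * (c * d) ≡ b * c * (a * d)
  ab[cd]≡bc[ad] = solve-∀
  ab[cd]≡ca[bd] : ∀ a b c d → a * b * (c * d) ≡ c * a * (b * d)
  ab[cd]≡ca[bd] = solve-∀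
  ab[cd]≡a[bc]d : ∀ a b c d → a * b * (c * d) ≡ a * (b * c) * d
  ab[cd]≡a[bc]d = solve-∀

∑nCk*mCk*kCj*kC[n∸j]≡nCj*mCj*mC[n∸j] : ∀ {n m j} → j ≤ n → n ≤ m →
  sumTo n (λ k → (n C k) * (m C k) * ((k C j) * (k C (n ∸ j))))
    ≡ (n C j) * (m C j) * (m C (n ∸ j))
∑nCk*mCk*kCj*kC[n∸j]≡nCj*mCj*mC[n∸j] {m = m} {j} j≤n n≤m with m≤n⇒∃[o]m+o≡n j≤n
... | a , refl = begin
  sumTo (j + a) (λ k → (n C k) * (m C k) * ((k C j) * (k C (j + a ∸ j))))
    ≡⟨ sumTo-cong (j + a) (λ k _ → cong (λ s → (n C k) * (m C k) * ((k C j) * (k C s)))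
                                        (m+n∸m≡n j a)) ⟩
  sumTo (j + a) f
    ≡⟨ cong (λ s → sumTo s f) (+-comm j a) ⟩
  sumTo (a + j) f
    ≡⟨ sumTo-shift a j f<a≡0 ⟩
  sumTo j (λ i → f (a + i))
    ≡⟨ sumTo-cong j (λ i i≤j → shifted-term m j a i≤j) ⟩
  sumTo j (λ i → (n C a) * (m C a) * (((m ∸ a) C i) * (a C (j ∸ i))))
    ≡⟨ *-distribˡ-sumTo ((n C a) * (m C a)) j _ ⟨
  (n C a) * (m C a) * sumTo j (λ i → ((m ∸ a) C i) * (a C (j ∸ i)))
    ≡⟨ cong ((n C a) * (m C a) *_) (vandermonde (m ∸ a) a j) ⟩
  (n C a) * (m C a) * ((m ∸ a + a) C j)
    ≡⟨ cong (λ s → (n C a) * (m C a) * (s C j)) (m∸n+n≡m (≤-trans (m≤n+m a j) n≤m)) ⟩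
  (n C a) * (m C a) * (m C j)
    ≡⟨ cong (λ s → s * (m C a) * (m C j)) nCa≡nCj ⟩
  (n C j) * (m C a) * (m C j)
    ≡⟨ ab*c≡ac*b (n C j) (m C a) (m C j) ⟩
  (n C j) * (m C j) * (m C a)
    ≡⟨ cong (λ s → (n C j) * (m C j) * (m C s)) (m+n∸m≡n j a) ⟨
  (n C j) * (m C j) * (m C (n ∸ j)) ∎
  where
  n : ℕ
  n = j + a
  f : ℕ → ℕ
  f k = (n C k) * (m C k) * ((k C j) * (k C a))
  f<a≡0 : ∀ k → k < a → f k ≡ 0
  f<a≡0 k k<a = begin
    (n C k) * (m C k) * ((k C j) * (k C a))  ≡⟨ cong (λ s → (n C k) * (m C k) * ((k C j) * s))
                                                      (k>n⇒nCk≡0 k<a) ⟩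
    (n C k) * (m C k) * ((k C j) * 0)        ≡⟨ cong ((n C k) * (m C k) *_) (*-zeroʳ (k C j)) ⟩
    (n C k) * (m C k) * 0                    ≡⟨ *-zeroʳ ((n C k) * (m C k)) ⟩
    0                                        ∎
  nCa≡nCj : n C a ≡ n C j
  nCa≡nCj = trans (nCk≡nC[n∸k] (m≤n+m a j)) (cong (n C_) (m+n∸n≡m j a))
  ab*c≡ac*b : ∀ a b c → a * b * c ≡ a * c * b
  ab*c≡ac*b = solve-∀

∑nCk*mCk*[2k]Cn≡∑nCk*mCk*mC[n∸k] : ∀ {n m} → n ≤ m →
  sumTo n (λ k → (n C k) * (m C k) * ((2 * k) C n))
    ≡ sumTo n (λ k → (n C k) * (m C k) * (m C (n ∸ k)))
∑nCk*mCk*[2k]Cn≡∑nCk*mCk*mC[n∸k] {n} {m} n≤m = begin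
  sumTo n (λ k → w k * ((2 * k) C n))
    ≡⟨ sumTo-cong n (λ k _ → cong (w k *_) [2k]Cn≡∑kCj*kC[n∸j]) ⟩
  sumTo n (λ k → w k * sumTo n (λ j → (k C j) * (k C (n ∸ j))))
    ≡⟨ sumTo-cong n (λ k _ → *-distribˡ-sumTo (w k) n _) ⟩
  sumTo n (λ k → sumTo n (λ j → w k * ((k C j) * (k C (n ∸ j)))))
    ≡⟨ sumTo-comm n n _ ⟩
  sumTo n (λ j → sumTo n (λ k → w k * ((k C j) * (k C (n ∸ j)))))
    ≡⟨ sumTo-cong n (λ j j≤n → ∑nCk*mCk*kCj*kC[n∸j]≡nCj*mCj*mC[n∸j] j≤n n≤m) ⟩
  sumTo n (λ k → w k * (m C (n ∸ k))) ∎
  where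
  w : ℕ → ℕ
  w k = (n C k) * (m C k)
  [2k]Cn≡∑kCj*kC[n∸j] : ∀ {k} → (2 * k) C n ≡ sumTo n (λ j → (k C j) * (k C (n ∸ j)))
  [2k]Cn≡∑kCj*kC[n∸j] {k} =
    trans (cong (λ s → (k + s) C n) (+-identityʳ k)) (sym (vandermonde k k n))

central-termwise : ∀ {n k} → k ≤ n →
  ((2 * n) C n) ^ 2 * (n !) ^ 3 * ((n C k) ^ 2 * ((3 * n) C (n + k)))
    ≡ (3 * n) ! * ((n C k) * ((2 * n) C k) * ((2 * n) C (n ∸ k)))
central-termwise {k = k} k≤n with m≤n⇒∃[o]m+o≡n k≤n
... | d , refl = *-cancelʳ-≡ _ _ D {{D≢0}} (trans lhs (sym rhs))
  where
  n e : ℕ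
  n = k + d
  e = d + n  -- 2n − k
  B X Y Z W : ℕ
  B = (2 * n) C n
  X = n C k
  Y = (3 * n) C (n + k)
  Z = (2 * n) C k
  W = (2 * n) C d
  D : ℕ
  D = k ! * d ! * ((n + k) ! * e !)
  D≢0 : NonZero D
  D≢0 = m*n≢0 _ _ {{k !* d !≢0}} {{(n + k) !* e !≢0}}
  n+n≡2n : ∀ u v → (u + v) + (u + v) ≡ 2 * (u + v)
  n+n≡2n = solve-∀
  [n+k]+e≡3n : ∀ u v → (u + v + u) + (v + (u + v)) ≡ 3 * (u + v)
  [n+k]+e≡3n = solve-∀
  k+e≡2n : ∀ u v → u + (v + (u + v)) ≡ 2 * (u + v)
  k+e≡2n = solve-∀
  d+[n+k]≡2n : ∀ u v → v + (u + v + u) ≡ 2 * (u + v)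
  d+[n+k]≡2n = solve-∀
  regroupˡ : ∀ b c x y p q r s →
    b * (b * 1) * (c * (c * (c * 1))) * (x * (x * 1) * y) * (p * q * (r * s))
      ≡ b * b * (c * c * c) * (x * (p * q)) * x * (y * (r * s))
  regroupˡ = solve-∀
  regroupˡ′ : ∀ b c x h → b * b * (c * c * c) * c * x * h ≡ b * (c * c) * (b * (c * c)) * x * h
  regroupˡ′ = solve-∀
  regroupʳ : ∀ h x z w p q r s →
    h * (x * z * w) * (p * q * (r * s)) ≡ h * x * (z * (p * s)) * (w * (q * r))
  regroupʳ = solve-∀
  regroupʳ′ : ∀ h x g → h * x * g * g ≡ g * g * x * h
  regroupʳ′ = solve-∀
  lhs : B ^ 2 * (n !) ^ 3 * (X ^ 2 * Y) * D ≡ (2 * n) ! * (2 * n) ! * X * (3 * n) !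
  lhs = begin
    B ^ 2 * (n !) ^ 3 * (X ^ 2 * Y) * D
      ≡⟨ regroupˡ B (n !) X Y (k !) (d !) ((n + k) !) (e !) ⟩
    B * B * (n ! * n ! * n !) * (X * (k ! * d !)) * X * (Y * ((n + k) ! * e !))
      ≡⟨ cong₂ (λ s t → B * B * (n ! * n ! * n !) * s * X * t)
               (nCk*[k!*r!]≡n! k d refl) (nCk*[k!*r!]≡n! (n + k) e ([n+k]+e≡3n k d)) ⟩
    B * B * (n ! * n ! * n !) * n ! * X * (3 * n) !
      ≡⟨ regroupˡ′ B (n !) X ((3 * n) !) ⟩
    B * (n ! * n !) * (B * (n ! * n !)) * X * (3 * n) !
      ≡⟨ cong (λ s → s * s * X * (3 * n) !) (nCk*[k!*r!]≡n! n n (n+n≡2n k d)) ⟩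
    (2 * n) ! * (2 * n) ! * X * (3 * n) ! ∎
  rhs : (3 * n) ! * (X * Z * ((2 * n) C (n ∸ k))) * D ≡ (2 * n) ! * (2 * n) ! * X * (3 * n) !
  rhs = begin
    (3 * n) ! * (X * Z * ((2 * n) C (n ∸ k))) * D
      ≡⟨ cong (λ s → (3 * n) ! * (X * Z * ((2 * n) C s)) * D) (m+n∸m≡n k d) ⟩
    (3 * n) ! * (X * Z * W) * D
      ≡⟨ regroupʳ ((3 * n) !) X Z W (k !) (d !) ((n + k) !) (e !) ⟩
    (3 * n) ! * X * (Z * (k ! * e !)) * (W * (d ! * (n + k) !))
      ≡⟨ cong₂ (λ s t → (3 * n) ! * X * s * t)
               (nCk*[k!*r!]≡n! k e (k+e≡2n k d)) (nCk*[k!*r!]≡n! d (n + k) (d+[n+k]≡2n k d)) ⟩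
    (3 * n) ! * X * (2 * n) ! * (2 * n) !
      ≡⟨ regroupʳ′ ((3 * n) !) X ((2 * n) !) ⟩
    (2 * n) ! * (2 * n) ! * X * (3 * n) ! ∎

mainTheorem18 : ∀ (n : ℕ) →
    ((2 * n) C n) ^ 2 * ((n !) ^ 3) * sumTo n (λ k → (n C k) ^ 2 * ((3 * n) C (n + k)))
      ≡ ((3 * n) !) * sumTo n (λ k → (n C k) * ((2 * n) C k) * ((2 * k) C n))
    × ((3 * n) !) * sumTo n (λ k → (n C k) * ((2 * n) C k) * ((2 * k) C n))
      ≡ ((3 * n) !) * sumTo n (λ k → (n C k) * ((2 * n) C k) * ((2 * n) C (n ∸ k)))
mainTheorem18 n = first , cong ((3 * n) ! *_) second
  where
  second : sumTo n (λ k → (n C k) * ((2 * n) C k) * ((2 * k) C n))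
             ≡ sumTo n (λ k → (n C k) * ((2 * n) C k) * ((2 * n) C (n ∸ k)))
  second = ∑nCk*mCk*[2k]Cn≡∑nCk*mCk*mC[n∸k] (m≤m+n n (n + 0))
  c : ℕ
  c = ((2 * n) C n) ^ 2 * (n !) ^ 3
  first : c * sumTo n (λ k → (n C k) ^ 2 * ((3 * n) C (n + k)))
            ≡ (3 * n) ! * sumTo n (λ k → (n C k) * ((2 * n) C k) * ((2 * k) C n))
  first = begin
    c * sumTo n (λ k → (n C k) ^ 2 * ((3 * n) C (n + k)))
      ≡⟨ *-distribˡ-sumTo c n _ ⟩
    sumTo n (λ k → c * ((n C k) ^ 2 * ((3 * n) C (n + k))))
      ≡⟨ sumTo-cong n (λ k → central-termwise) ⟩
    sumTo n (λ k → (3 * n) ! * ((n C k) * ((2 * n) C k) * ((2 * n) C (n ∸ k))))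
      ≡⟨ *-distribˡ-sumTo ((3 * n) !) n _ ⟨
    (3 * n) ! * sumTo n (λ k → (n C k) * ((2 * n) C k) * ((2 * n) C (n ∸ k)))
      ≡⟨ cong ((3 * n) ! *_) second ⟨
    (3 * n) ! * sumTo n (λ k → (n C k) * ((2 * n) C k) * ((2 * k) C n)) ∎
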